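{- For all integers $m,n\geq 0$, the lattice $\mathbf{W}(m,n)$ is semidistributive.
   Context: An $(m,n)$-word is a word $\mathfrak{w}=w_1w_2\cdots w_n$ of length $n$ over the alphabet $\{0,1,\dots,m+1\}$ such that (MN1) $w_1\neq m+1$, and (MN2) for every $s$ with $1\le s\le m$ and every index $i$, if $w_i=s$ then $w_j\ge s$ for all $j<i$. $\mathbf{W}(m,n)$ is the set of $(m,n)$-words ordered componentwise ($\mathfrak{u}\le\mathfrak{v}$ iff $u_i\le v_i$ for all $i$); this is a lattice. A lattice is join-semidistributive if $x\vee y=x\vee z$ implies $x\vee(y\wedge z)=x\vee y$ for all $x,y,z$, meet-semidistributive if dually $x\wedge y=x\wedge z$ implies $x\wedge(y\vee z)=x\wedge y$, and semidistributive if both hold. -}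

module Defs where

open import Data.Nat using (ℕ; zero; suc; _≤_)
open import Data.Fin using (Fin; toℕ) renaming (_<_ to _<ᶠ_)
open import Data.Vec using (Vec; lookup)
open import Data.Product using (_×_)
open import Relation.Binary.PropositionalEquality using (_≡_; _≢_)

-- A word of length n is a vector of naturals; positions are Fin n
-- (position i corresponds to w_{toℕ i + 1}).
Word : ℕ → Set
Word n = Vec ℕ n

IsWord : (m n : ℕ) → Word n → Set
IsWord m n w =
  (∀ (i : Fin n) → lookup w i ≤ suc m)
  × (∀ (i : Fin n) → toℕ i ≡ 0 → lookup w i ≢ suc m)
  × (∀ (i j : Fin n) → 1 ≤ lookup w i → lookup w i ≤ m →
        j <ᶠ i → lookup w i ≤ lookup w j)

_≼_ : ∀ {n} → Word n → Word n → Set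
u ≼ v = ∀ i → lookup u i ≤ lookup v i

IsJoin : (m n : ℕ) → (x y j : Word n) → Set
IsJoin m n x y j =
  IsWord m n j × x ≼ j × y ≼ j ×
  (∀ u → IsWord m n u → x ≼ u → y ≼ u → j ≼ u)

IsMeet : (m n : ℕ) → (x y c : Word n) → Set
IsMeet m n x y c =
  IsWord m n c × c ≼ x × c ≼ y ×
  (∀ u → IsWord m n u → u ≼ x → u ≼ y → u ≼ c)

JoinSemidistributive : ℕ → ℕ → Set
JoinSemidistributive m n =
  ∀ (x y z a b c d : Word n) →
  IsWord m n x → IsWord m n y → IsWord m n z →
  IsJoin m n x y a → IsJoin m n x z b → a ≡ b →
  IsMeet m n y z c → IsJoin m n x c d → d ≡ a

MeetSemidistributive : ℕ → ℕ → Set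
MeetSemidistributive m n =
  ∀ (x y z a b c d : Word n) →
  IsWord m n x → IsWord m n y → IsWord m n z →
  IsMeet m n x y a → IsMeet m n x z b → a ≡ b →
  IsJoin m n y z c → IsMeet m n x c d → d ≡ a

Semidistributive : ℕ → ℕ → Set
Semidistributive m n = JoinSemidistributive m n × MeetSemidistributive m n

-- Joins in W(m,n) are componentwise maxima.  Condition (MN2) only constrains
-- the letters before a position, so keeping a prefix of a word, putting a
-- suitable letter s at position i and zeros afterwards again gives a word.
--
-- Join-semidistributivity: if x ∨ y = x ∨ z and y_i > x_i, then z_i = y_i, and
-- the least word with letter y_i at position i lies below y and z, hence below
-- y ∧ z; so y ≤ x ∨ (y ∧ z).
--
-- Meet-semidistributivity: let d = x ∧ (y ∨ z) and a = x ∧ y = x ∧ z.  Going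
-- from left to right, if d ≤ a before position i, then the prefix of a followed
-- by the letter d_i is a word below x and below whichever of y, z has the
-- letter max(y_i, z_i); hence it is below a, and d_i ≤ a_i.
module Submission where

open import Defs
open import Level using (0ℓ)
open import Data.Nat using (ℕ; suc; _≤_; _<_; _⊔_; z≤n; _≤?_)
open import Data.Nat.Properties
open import Data.Fin using (Fin; toℕ) renaming (_<_ to _<ᶠ_)
open import Data.Fin.Properties using () renaming (<-cmp to <ᶠ-cmp; <-irrefl to <ᶠ-irrefl)
open import Data.Fin.Induction using () renaming (<-wellFounded to <ᶠ-wellFounded)
open import Data.Vec using (lookup; tabulate; zipWith; replicate)
open import Data.Vec.Properties using (lookup∘tabulate; lookup-zipWith; lookup-replicate)
open import Data.Vec.Relation.Binary.Pointwise.Extensional using (ext; Pointwise-≡⇒≡)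
open import Data.Product using (_,_)
open import Data.Sum using (inj₁; inj₂)
open import Induction.WellFounded using (module All)
open import Relation.Binary.Definitions using (Tri; tri<; tri≈; tri>)
open import Relation.Nullary using (yes; no)
open import Relation.Nullary.Negation using (contradiction)
open import Relation.Binary.PropositionalEquality

private
  variable
    m n s : ℕ
    j : Fin n
    u v : Word n

≼-antisym : u ≼ v → v ≼ u → u ≡ v
≼-antisym p q = Pointwise-≡⇒≡ (ext λ k → ≤-antisym (p k) (q k))

letter-≤-prefix : ∀ (w : Word n) → IsWord m n w → ∀ i j → lookup w i ≤ m → j <ᶠ i →
                  lookup w i ≤ lookup w j
letter-≤-prefix w (_ , _ , mn2) i j s≤m j<i with 1 ≤? lookup w i
... | yes 1≤s = mn2 i j 1≤s s≤m j<i
... | no 1≰s = ≤-trans (≤-reflexive (n<1⇒n≡0 (≰⇒> 1≰s))) z≤n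

replicate-isWord : s ≤ m → IsWord m n (replicate n s)
replicate-isWord {s} {m} s≤m =
  (λ k → subst (_≤ suc m) (sym (lookup-replicate k s)) (m≤n⇒m≤1+n s≤m)) ,
  (λ k _ s≡1+m → 1+n≰n (subst (_≤ m) (trans (sym (lookup-replicate k s)) s≡1+m) s≤m)) ,
  (λ k l _ _ _ → ≤-reflexive (trans (lookup-replicate k s) (sym (lookup-replicate l s))))

_∨ʷ_ : Word n → Word n → Word n
_∨ʷ_ = zipWith _⊔_

lookup-∨ʷ : ∀ (u v : Word n) k → lookup (u ∨ʷ v) k ≡ lookup u k ⊔ lookup v k
lookup-∨ʷ u v k = lookup-zipWith _⊔_ k u v

∨ʷ-isWord : ∀ (u v : Word n) → IsWord m n u → IsWord m n v → IsWord m n (u ∨ʷ v)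
∨ʷ-isWord {m = m} u v (u-bound , u-mn1 , u-mn2) (v-bound , v-mn1 , v-mn2) = bound , mn1 , mn2
  where
  bound : ∀ k → lookup (u ∨ʷ v) k ≤ suc m
  bound k rewrite lookup-∨ʷ u v k = ⊔-lub (u-bound k) (v-bound k)
  mn1 : ∀ k → toℕ k ≡ 0 → lookup (u ∨ʷ v) k ≢ suc m
  mn1 k k≡0 rewrite lookup-∨ʷ u v k with ⊔-sel (lookup u k) (lookup v k)
  ... | inj₁ e rewrite e = u-mn1 k k≡0
  ... | inj₂ e rewrite e = v-mn1 k k≡0
  mn2 : ∀ k l → 1 ≤ lookup (u ∨ʷ v) k → lookup (u ∨ʷ v) k ≤ m →
        l <ᶠ k → lookup (u ∨ʷ v) k ≤ lookup (u ∨ʷ v) l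
  mn2 k l p q l<k rewrite lookup-∨ʷ u v k | lookup-∨ʷ u v l with ⊔-sel (lookup u k) (lookup v k)
  ... | inj₁ e rewrite e = ≤-trans (u-mn2 k l p q l<k) (m≤m⊔n _ _)
  ... | inj₂ e rewrite e = ≤-trans (v-mn2 k l p q l<k) (m≤n⊔m _ _)

join-lookup : ∀ (x y a : Word n) → IsWord m n x → IsWord m n y → IsJoin m n x y a →
              ∀ k → lookup a k ≡ lookup x k ⊔ lookup y k
join-lookup x y a wx wy (_ , x≼a , y≼a , a-least) k =
  trans (cong (λ v → lookup v k) a≡x∨y) (lookup-∨ʷ x y k)
  where
  a≡x∨y : a ≡ x ∨ʷ y
  a≡x∨y = ≼-antisym
    (a-least (x ∨ʷ y) (∨ʷ-isWord x y wx wy)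
      (λ l → subst (_ ≤_) (sym (lookup-∨ʷ x y l)) (m≤m⊔n _ _))
      (λ l → subst (_ ≤_) (sym (lookup-∨ʷ x y l)) (m≤n⊔m _ _)))
    (λ l → subst (_≤ _) (sym (lookup-∨ʷ x y l)) (⊔-lub (x≼a l) (y≼a l)))

cutLetter : {j i : Fin n} → Word n → ℕ → Tri (j <ᶠ i) (j ≡ i) (i <ᶠ j) → ℕ
cutLetter {j = j} w s (tri< _ _ _) = lookup w j
cutLetter w s (tri≈ _ _ _) = s
cutLetter w s (tri> _ _ _) = 0

truncate : Word n → Fin n → ℕ → Word n
truncate w i s = tabulate λ j → cutLetter w s (<ᶠ-cmp j i)

lookup-truncate : ∀ (w : Word n) i s j → lookup (truncate w i s) j ≡ cutLetter w s (<ᶠ-cmp j i)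
lookup-truncate w i s j = lookup∘tabulate _ j

truncate-at : ∀ (w : Word n) i s → lookup (truncate w i s) i ≡ s
truncate-at w i s rewrite lookup-truncate w i s i with <ᶠ-cmp i i
... | tri< i<i _ _ = contradiction i<i (<ᶠ-irrefl refl)
... | tri≈ _ _ _ = refl
... | tri> _ _ i<i = contradiction i<i (<ᶠ-irrefl refl)

truncate-before : ∀ (w : Word n) i s → j <ᶠ i → lookup (truncate w i s) j ≡ lookup w j
truncate-before {j = j} w i s j<i rewrite lookup-truncate w i s j with <ᶠ-cmp j i
... | tri< _ _ _ = refl
... | tri≈ j≮i _ _ = contradiction j<i j≮i
... | tri> j≮i _ _ = contradiction j<i j≮i

truncate-isWord : ∀ (w : Word n) i s → IsWord m n w →
                  s ≤ suc m → (toℕ i ≡ 0 → s ≢ suc m) →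
                  (1 ≤ s → s ≤ m → ∀ j → j <ᶠ i → s ≤ lookup w j) →
                  IsWord m n (truncate w i s)
truncate-isWord {n} {m} w i s (w-bound , w-mn1 , w-mn2) s-bound s-mn1 s-mn2 =
  bound , mn1 , mn2
  where
  t : Word n
  t = truncate w i s
  bound : ∀ k → lookup t k ≤ suc m
  bound k rewrite lookup-truncate w i s k with <ᶠ-cmp k i
  ... | tri< _ _ _ = w-bound k
  ... | tri≈ _ _ _ = s-bound
  ... | tri> _ _ _ = z≤n
  mn1 : ∀ k → toℕ k ≡ 0 → lookup t k ≢ suc m
  mn1 k k≡0 rewrite lookup-truncate w i s k with <ᶠ-cmp k i
  ... | tri< _ _ _ = w-mn1 k k≡0
  ... | tri≈ _ refl _ = s-mn1 k≡0
  ... | tri> _ _ _ = λ ()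
  mn2 : ∀ k l → 1 ≤ lookup t k → lookup t k ≤ m → l <ᶠ k → lookup t k ≤ lookup t l
  mn2 k l p q l<k rewrite lookup-truncate w i s k with <ᶠ-cmp k i
  ... | tri< k<i _ _ rewrite truncate-before w i s (<-trans l<k k<i) = w-mn2 k l p q l<k
  ... | tri≈ _ refl _ rewrite truncate-before w i s l<k = s-mn2 p q l l<k
  mn2 k l () q l<k | tri> _ _ _

truncate-≼ : ∀ (w v : Word n) i s → (∀ j → j <ᶠ i → lookup w j ≤ lookup v j) →
             s ≤ lookup v i →
             truncate w i s ≼ v
truncate-≼ w v i s prefix≤ s≤ k rewrite lookup-truncate w i s k with <ᶠ-cmp k i
... | tri< k<i _ _ = prefix≤ k k<i
... | tri≈ _ refl _ = s≤
... | tri> _ _ _ = z≤n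

-- The letter filling the prefix of the least word with letter s at a given
-- position: s itself, except that the letter m + 1 imposes no condition.
floorLetter : ℕ → ℕ → ℕ
floorLetter m s with s ≤? m
... | yes _ = s
... | no _ = 0

floorLetter≤ : ∀ m s → floorLetter m s ≤ m
floorLetter≤ m s with s ≤? m
... | yes s≤m = s≤m
... | no _ = z≤n

floorLetter-≤-prefix : ∀ (w : Word n) → IsWord m n w → ∀ i j → j <ᶠ i →
                       floorLetter m (lookup w i) ≤ lookup w j
floorLetter-≤-prefix {m = m} w ww i j j<i with lookup w i ≤? m
... | yes s≤m = letter-≤-prefix w ww i j s≤m j<i
... | no _ = z≤n

leastAgreeingAt : ℕ → Word n → Fin n → Word n
leastAgreeingAt {n} m w i = truncate (replicate n (floorLetter m (lookup w i))) i (lookup w i)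

leastAgreeingAt-isWord : ∀ (w : Word n) i → IsWord m n w → IsWord m n (leastAgreeingAt m w i)
leastAgreeingAt-isWord {n} {m} w i (w-bound , w-mn1 , _) =
  truncate-isWord _ i (lookup w i) (replicate-isWord (floorLetter≤ m (lookup w i)))
    (w-bound i) (w-mn1 i) s≤prefix
  where
  s≤prefix : 1 ≤ lookup w i → lookup w i ≤ m → ∀ j → j <ᶠ i →
             lookup w i ≤ lookup (replicate n (floorLetter m (lookup w i))) j
  s≤prefix _ s≤m j _ rewrite lookup-replicate j (floorLetter m (lookup w i)) with lookup w i ≤? m
  ... | yes _ = ≤-refl
  ... | no s≰m = contradiction s≤m s≰m

leastAgreeingAt-≼ : ∀ m (v w : Word n) i → IsWord m n v → lookup v i ≡ lookup w i →
                    leastAgreeingAt m w i ≼ v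
leastAgreeingAt-≼ {n} m v w i wv vi≡wi =
  truncate-≼ _ v i (lookup w i) prefix≤ (≤-reflexive (sym vi≡wi))
  where
  prefix≤ : ∀ j → j <ᶠ i → lookup (replicate n (floorLetter m (lookup w i))) j ≤ lookup v j
  prefix≤ j j<i rewrite lookup-replicate j (floorLetter m (lookup w i)) | sym vi≡wi =
    floorLetter-≤-prefix v wv i j j<i

⊔-cancelˡ-< : ∀ {p q r} → p < q → p ⊔ q ≡ p ⊔ r → r ≡ q
⊔-cancelˡ-< {p} {q} {r} p<q p⊔q≡p⊔r with ⊔-sel p r
... | inj₁ p⊔r≡p =
  contradiction (trans (sym (m≤n⇒m⊔n≡n (<⇒≤ p<q))) (trans p⊔q≡p⊔r p⊔r≡p)) (>⇒≢ p<q)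
... | inj₂ p⊔r≡r = trans (sym p⊔r≡r) (trans (sym p⊔q≡p⊔r) (m≤n⇒m⊔n≡n (<⇒≤ p<q)))

joinSemidistributive : (m n : ℕ) → JoinSemidistributive m n
joinSemidistributive m n x y z a _ c d wx wy wz x∨y@(wa , x≼a , y≼a , a-least) x∨z refl
  (_ , c≼y , _ , c-greatest) (wd , x≼d , c≼d , d-least) =
  ≼-antisym (d-least a wa x≼a (λ k → ≤-trans (c≼y k) (y≼a k))) (a-least d wd x≼d y≼d)
  where
  y≼d : y ≼ d
  y≼d i with lookup y i ≤? lookup x i
  ... | yes yi≤xi = ≤-trans yi≤xi (x≼d i)
  ... | no yi≰xi = begin
    lookup y i                       ≡⟨ sym (truncate-at _ i (lookup y i)) ⟩
    lookup (leastAgreeingAt m y i) i ≤⟨ least≼c i ⟩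
    lookup c i                       ≤⟨ c≼d i ⟩
    lookup d i                       ∎
    where
    open ≤-Reasoning
    zi≡yi : lookup z i ≡ lookup y i
    zi≡yi = ⊔-cancelˡ-< (≰⇒> yi≰xi)
              (trans (sym (join-lookup x y a wx wy x∨y i)) (join-lookup x z a wx wz x∨z i))
    least≼c : leastAgreeingAt m y i ≼ c
    least≼c = c-greatest (leastAgreeingAt m y i) (leastAgreeingAt-isWord y i wy)
                (leastAgreeingAt-≼ m y y i wy refl) (leastAgreeingAt-≼ m z y i wz zi≡yi)

letter-≤-meet : ∀ (x v a w : Word n) i → IsMeet m n x v a → IsWord m n w → w ≼ x →
                lookup w i ≤ lookup v i → (∀ {j} → j <ᶠ i → lookup w j ≤ lookup a j) →
                lookup w i ≤ lookup a i
letter-≤-meet {n} {m} x v a w i (wa , a≼x , a≼v , a-greatest) (w-bound , w-mn1 , w-mn2)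
  w≼x wi≤vi w≤a-before = begin
    lookup w i   ≡⟨ sym (truncate-at a i (lookup w i)) ⟩
    lookup cut i ≤⟨ a-greatest cut cut-isWord cut≼x cut≼v i ⟩
    lookup a i   ∎
  where
  open ≤-Reasoning
  cut : Word n
  cut = truncate a i (lookup w i)
  cut≼x : cut ≼ x
  cut≼x = truncate-≼ a x i (lookup w i) (λ j _ → a≼x j) (w≼x i)
  cut≼v : cut ≼ v
  cut≼v = truncate-≼ a v i (lookup w i) (λ j _ → a≼v j) wi≤vi
  cut-isWord : IsWord m n cut
  cut-isWord = truncate-isWord a i (lookup w i) wa (w-bound i) (w-mn1 i)
    (λ p q j j<i → ≤-trans (w-mn2 i j p q j<i) (w≤a-before j<i))

meetSemidistributive : (m n : ℕ) → MeetSemidistributive m n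
meetSemidistributive m n x y z a _ c d _ wy wz x∧y@(wa , a≼x , a≼y , _) x∧z refl
  y∨z@(_ , y≼c , _) (wd , d≼x , d≼c , d-greatest) =
  ≼-antisym (All.wfRec <ᶠ-wellFounded 0ℓ _ step)
            (d-greatest a wa a≼x (λ k → ≤-trans (a≼y k) (y≼c k)))
  where
  step : ∀ i → (∀ {j} → j <ᶠ i → lookup d j ≤ lookup a j) → lookup d i ≤ lookup a i
  step i d≤a-before
    with ⊔-sel (lookup y i) (lookup z i) | subst (_ ≤_) (join-lookup y z c wy wz y∨z i) (d≼c i)
  ... | inj₁ e | di≤yi⊔zi =
    letter-≤-meet x y a d i x∧y wd d≼x (subst (_ ≤_) e di≤yi⊔zi) d≤a-before
  ... | inj₂ e | di≤yi⊔zi =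
    letter-≤-meet x z a d i x∧z wd d≼x (subst (_ ≤_) e di≤yi⊔zi) d≤a-before

corollary4p4 : (m n : ℕ) → Semidistributive m n
corollary4p4 m n = joinSemidistributive m n , meetSemidistributive m n
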